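{- Let $G=(V,E)$ be a connected undirected graph and let $k$ be a positive integer. Then the algorithm $TopDown$ (described in the context) run on $G$ correctly outputs all connected induced subgraphs of $G$ of order $k$, i.e. the vertex sets it outputs are exactly the elements of $CIS(G,k)=\{U\subseteq V : G(U)\text{ is connected and }|U|=k\}$.
   Context: For $U\subseteq V$, $G(U)$ is the subgraph of $G$ induced by $U$; its order is $|U|$. An articulation point of a connected graph is a vertex whose removal (with its incident edges) disconnects the graph; a non-articulation point is called deletable. The algorithm $TopDown$: initially set $Y=\emptyset$, let $N$ be the set of non-articulation points of $G$, and call $TopDown(V,N,Y)$. The recursive procedure $TopDown(C,N,Y)$ (where $C\subseteq V$ is the current vertex set, and each call works with its own copy of the guarding set $Y$, so that changes made to $Y$ inside a call are undone when it returns) does: if $|C|=k$, output $C$. Then, for each vertex $u\in N$ in turn: let $C'=C\setminus\{u\}$; let $X$ be the set of non-articulation points of $G(C')$; let $N'=X\setminus Y$; call $TopDown(C',N',Y)$; then set $Y=Y\cup\{u\}$; and if now $|Y|=k$, output $Y$ if $G(Y)$ is connected and terminate the loop (break). -}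

module Defs where

open import Data.Nat using (ℕ; zero; suc; _≟_)
open import Data.Bool using (Bool; true; false; _∧_; if_then_else_)
open import Data.Fin using (Fin)
open import Data.Fin.Subset using (Subset; _∈_; _∉_; ⁅_⁆; _∪_; _─_; _-_; ∣_∣; ⊥; ⊤)
open import Data.Fin.Subset.Properties using (_∈?_)
open import Data.List using (List; []; _∷_; _++_; filter)
open import Data.List.Base using (allFin)
open import Data.Vec using (tabulate)
open import Data.Empty using () renaming (⊥ to Empty)
open import Relation.Nullary using (Dec; yes; no; ¬_)
open import Relation.Nullary.Decidable using (isYes; ⌊_⌋)

record Graph (n : ℕ) : Set₁ where
  field
    Adj     : Fin n → Fin n → Set
    sym     : ∀ {x y} → Adj x y → Adj y x
    irrefl  : ∀ {x} → ¬ Adj x x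
open Graph public

data PathIn {n : ℕ} (G : Graph n) (U : Subset n) : Fin n → Fin n → Set where
  here : ∀ {x} → x ∈ U → PathIn G U x x
  step : ∀ {x y z} → x ∈ U → Adj G x y → PathIn G U y z → PathIn G U x z

Connected : ∀ {n} → Graph n → Subset n → Set
Connected G U = ∀ x y → x ∈ U → y ∈ U → PathIn G U x y

module TopDown {n : ℕ} (G : Graph n) (conn? : (U : Subset n) → Dec (Connected G U))
               (k : ℕ) where

  nonArt : Subset n → Subset n
  nonArt C = tabulate (λ v → isYes (v ∈? C) ∧ isYes (conn? (C - v)))

  members : Subset n → List (Fin n)
  members S = filter (_∈? S) (allFin n)

  -- fuel bounds the recursion depth (|C| strictly decreases at each call)
  mutual
    topDown : ℕ → Subset n → Subset n → Subset n → List (Subset n)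
    topDown zero    C N Y = []
    topDown (suc f) C N Y =
      (if ⌊ ∣ C ∣ ≟ k ⌋ then C ∷ [] else []) ++ loop f C (members N) Y

    -- the "for each u ∈ N in turn" loop (vertices in increasing order),
    -- with the loop-local copy Y of the guarding set
    loop : ℕ → Subset n → List (Fin n) → Subset n → List (Subset n)
    loop f C []       Y = []
    loop f C (u ∷ us) Y =
      topDown f C' (nonArt C' ─ Y) Y ++
        (if ⌊ ∣ Y' ∣ ≟ k ⌋
           then (if isYes (conn? Y') then Y' ∷ [] else [])
           else loop f C us Y')
      where
        C' = C - u
        Y' = Y ∪ ⁅ u ⁆

  output : List (Subset n)
  output = topDown (suc n) ⊤ (nonArt ⊤) ⊥

module Submission where

-- Soundness: every call works on a connected C, because only deletable
-- vertices are ever removed, and a set is output only after its size and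
-- connectivity have been tested.  Completeness: for a target U the calls
-- leading to U keep Y ⊆ U ⊆ C, with every deletable vertex of C outside Y in N.
-- While C ≠ U, some deletable vertex of C lies outside U, so the loop meets a
-- vertex outside U before it runs out; until then it only guards vertices of
-- U, and if Y fills up to size k on the way then Y = U is output.  Otherwise
-- it deletes that vertex and recurses with the invariant intact.

open import Defs
open import Data.Nat using (ℕ; _≤_)
open import Data.Fin.Subset using (Subset; ⊤; ∣_∣)
open import Data.Product using (_×_)
open import Data.List.Membership.Propositional using (_∈_)
open import Relation.Binary.PropositionalEquality using (_≡_)
open import Relation.Nullary using (Dec)
open import Function.Bundles using (_⇔_)

open import Data.Nat using (zero; suc; _+_; _<_; s≤s; _≟_)
open import Data.Nat.Properties using (<⇒≢; <⇒≱; +-suc; +-monoʳ-≤; m≤m+n; ≤-reflexive; <-≤-trans; module ≤-Reasoning)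
open import Data.Fin using (Fin)
open import Data.Fin.Subset using (_─_; _-_; _∪_; ⁅_⁆; _⊆_; Nonempty; inside; outside)
  renaming (_∈_ to _∈ₛ_; _∉_ to _∉ₛ_; ⊥ to ∅)
open import Data.Fin.Subset.Properties
open import Data.Fin.Properties using (any?)
open import Data.Product using (∃-syntax; _,_; proj₂)
open import Data.Sum using (_⊎_; inj₁; inj₂)
import Data.Sum as Sum
open import Data.Bool using (if_then_else_)
open import Data.Bool.Properties using (T-∧; T-≡)
open import Data.Vec using (_∷_)
open import Data.Vec.Base using (there)
open import Data.Vec.Properties using (lookup∘tabulate; []=⇒lookup; lookup⇒[]=)
open import Data.List using ([]; _∷_; _++_; allFin)
open import Data.List.Relation.Unary.All as All using (All; []; _∷_)
open import Data.List.Relation.Unary.All.Properties using (++⁺)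
open import Data.List.Relation.Unary.Any using (Any; here; there)
open import Data.List.Membership.Propositional using (lose)
open import Data.List.Membership.Propositional.Properties using (∈-filter⁺; ∈-filter⁻; ∈-allFin; ∈-++⁺ʳ; ∈-++⁺ˡ)
open import Function using (_∘_; case_of_)
open import Function.Bundles using (mk⇔; Equivalence)
open import Relation.Binary.PropositionalEquality using (refl; trans; subst; cong) renaming (sym to ≡-sym)
open import Relation.Nullary using (yes; no; contradiction; ¬?; _×-dec_)
open import Relation.Nullary.Decidable using (isYes; ⌊_⌋; toWitness; fromWitness; decidable-stable)

x∈p─q⇒x∉q : ∀ {n} (p q : Subset n) {x : Fin n} → x ∈ₛ p ─ q → x ∉ₛ q
x∈p─q⇒x∉q (_ ∷ p) (inside  ∷ q) {Fin.zero}  ()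
x∈p─q⇒x∉q (_ ∷ p) (outside ∷ q) {Fin.zero}  _         ()
x∈p─q⇒x∉q (_ ∷ p) (_       ∷ q) {Fin.suc x} (there h) (there x∈q) = x∈p─q⇒x∉q p q h x∈q

module _ {n : ℕ} where

  ⊆⊎∉ : (p q : Subset n) → p ⊆ q ⊎ ∃[ x ] (x ∈ₛ p × x ∉ₛ q)
  ⊆⊎∉ p q with any? (λ x → (x ∈? p) ×-dec ¬? (x ∈? q))
  ... | yes witness = inj₂ witness
  ... | no none     = inj₁ λ {x} x∈p → decidable-stable (x ∈? q) (λ x∉q → none (x , x∈p , x∉q))

  p⊆q∧∣p∣≡∣q∣⇒p≡q : {p q : Subset n} → p ⊆ q → ∣ p ∣ ≡ ∣ q ∣ → p ≡ q
  p⊆q∧∣p∣≡∣q∣⇒p≡q {p} {q} p⊆q ∣p∣≡∣q∣ with ⊆⊎∉ q p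
  ... | inj₁ q⊆p             = ⊆-antisym p⊆q q⊆p
  ... | inj₂ (x , x∈q , x∉p) = contradiction ∣p∣≡∣q∣ (<⇒≢ (p⊂q⇒∣p∣<∣q∣ (p⊆q , x , x∈q , x∉p)))

  0<∣p∣⇒Nonempty : {p : Subset n} → 0 < ∣ p ∣ → Nonempty p
  0<∣p∣⇒Nonempty {p} 0<∣p∣ with ⊆⊎∉ p ∅
  ... | inj₁ p⊆∅           = contradiction (subst (∣ p ∣ ≤_) (∣⊥∣≡0 n) (p⊆q⇒∣p∣≤∣q∣ p⊆∅)) (<⇒≱ 0<∣p∣)
  ... | inj₂ (x , x∈p , _) = x , x∈p

  x∈p∪⁅y⁆⁻ : {p : Subset n} {x y : Fin n} → x ∈ₛ p ∪ ⁅ y ⁆ → x ∈ₛ p ⊎ x ≡ y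
  x∈p∪⁅y⁆⁻ {p} {y = y} = Sum.map₂ (x∈⁅y⁆⇒x≡y y) ∘ x∈p∪q⁻ p ⁅ y ⁆

  y∈p∪⁅y⁆ : (p : Subset n) (y : Fin n) → y ∈ₛ p ∪ ⁅ y ⁆
  y∈p∪⁅y⁆ p y = x∈p∪q⁺ (inj₂ (x∈⁅x⁆ y))

  p⊆r∧y∈r⇒p∪⁅y⁆⊆r : {p r : Subset n} {y : Fin n} → p ⊆ r → y ∈ₛ r → p ∪ ⁅ y ⁆ ⊆ r
  p⊆r∧y∈r⇒p∪⁅y⁆⊆r p⊆r y∈r x∈p∪⁅y⁆ with x∈p∪⁅y⁆⁻ x∈p∪⁅y⁆
  ... | inj₁ x∈p  = p⊆r x∈p
  ... | inj₂ refl = y∈r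

  p⊆q∪⁅y⁆⇒p-y⊆q : {p q : Subset n} {y : Fin n} → p ⊆ q ∪ ⁅ y ⁆ → p - y ⊆ q
  p⊆q∪⁅y⁆⇒p-y⊆q {p} {y = y} p⊆q∪⁅y⁆ x∈p-y with x∈p∪⁅y⁆⁻ (p⊆q∪⁅y⁆ (p─q⊆p p ⁅ y ⁆ x∈p-y))
  ... | inj₁ x∈q  = x∈q
  ... | inj₂ refl = contradiction (x∈⁅x⁆ y) (x∈p─q⇒x∉q p ⁅ y ⁆ x∈p-y)

  q⊆p∧y∉q⇒q⊆p-y : {p q : Subset n} {y : Fin n} → q ⊆ p → y ∉ₛ q → q ⊆ p - y
  q⊆p∧y∉q⇒q⊆p-y q⊆p y∉q x∈q = x∈p∧x≢y⇒x∈p-y (q⊆p x∈q) λ { refl → y∉q x∈q }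

module _ {n : ℕ} (G : Graph n) where

  PathIn-source : ∀ {C a b} → PathIn G C a b → a ∈ₛ C
  PathIn-source (here a∈C)     = a∈C
  PathIn-source (step a∈C _ _) = a∈C

  PathIn-mono : ∀ {C D a b} → C ⊆ D → PathIn G C a b → PathIn G D a b
  PathIn-mono C⊆D (here a∈C)       = here (C⊆D a∈C)
  PathIn-mono C⊆D (step a∈C ab bc) = step (C⊆D a∈C) ab (PathIn-mono C⊆D bc)

  PathIn-++ : ∀ {C a b c} → PathIn G C a b → PathIn G C b c → PathIn G C a c
  PathIn-++ (here _)         q = q
  PathIn-++ (step a∈C ab bc) q = step a∈C ab (PathIn-++ bc q)

  PathIn-exit : ∀ {C W a b} → PathIn G C a b → a ∈ₛ W → b ∉ₛ W →
                ∃[ x ] ∃[ w ] (x ∈ₛ W × w ∈ₛ C × w ∉ₛ W × Adj G x w)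
  PathIn-exit (here _) a∈W b∉W = contradiction a∈W b∉W
  PathIn-exit {W = W} {a = a} (step {y = y} _ ay yb) a∈W b∉W with y ∈? W
  ... | yes y∈W = PathIn-exit yb y∈W b∉W
  ... | no  y∉W = a , y , a∈W , PathIn-source yb , y∉W , ay

  Connected-∪⁅⁆ : ∀ {W x w} → Connected G W → x ∈ₛ W → Adj G x w → Connected G (W ∪ ⁅ w ⁆)
  Connected-∪⁅⁆ {W} {x} {w} W-conn x∈W xw _ _ a∈W' b∈W' = PathIn-++ (to-x a∈W') (from-x b∈W')
    where
    inW' : ∀ {c d} → c ∈ₛ W → d ∈ₛ W → PathIn G (W ∪ ⁅ w ⁆) c d
    inW' c∈W d∈W = PathIn-mono (p⊆p∪q ⁅ w ⁆) (W-conn _ _ c∈W d∈W)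

    to-x : ∀ {c} → c ∈ₛ W ∪ ⁅ w ⁆ → PathIn G (W ∪ ⁅ w ⁆) c x
    to-x c∈W' with x∈p∪⁅y⁆⁻ c∈W'
    ... | inj₁ c∈W  = inW' c∈W x∈W
    ... | inj₂ refl = step (y∈p∪⁅y⁆ W w) (Graph.sym G xw) (inW' x∈W x∈W)

    from-x : ∀ {d} → d ∈ₛ W ∪ ⁅ w ⁆ → PathIn G (W ∪ ⁅ w ⁆) x d
    from-x d∈W' with x∈p∪⁅y⁆⁻ d∈W'
    ... | inj₁ d∈W  = inW' x∈W d∈W
    ... | inj₂ refl = step (p⊆p∪q ⁅ w ⁆ x∈W) xw (here (y∈p∪⁅y⁆ W w))

  -- Grow W inside C one neighbour at a time; the vertex w whose addition
  -- exhausts C is deletable, as C - w is the connected set W.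
  ∃-deletable-outside : ∀ {C W b} → Connected G C → Connected G W → W ⊆ C → Nonempty W →
                        b ∈ₛ C → b ∉ₛ W → ∃[ v ] (v ∈ₛ C × v ∉ₛ W × Connected G (C - v))
  ∃-deletable-outside {C} {W} C-conn = grow ∣ C ∣ (m≤m+n ∣ C ∣ ∣ W ∣)
    where
    grow : ∀ d {W b} → ∣ C ∣ ≤ d + ∣ W ∣ → Connected G W → W ⊆ C → Nonempty W →
           b ∈ₛ C → b ∉ₛ W → ∃[ v ] (v ∈ₛ C × v ∉ₛ W × Connected G (C - v))
    grow zero    bound _ W⊆C _ b∈C b∉W =
      contradiction bound (<⇒≱ (p⊂q⇒∣p∣<∣q∣ (W⊆C , _ , b∈C , b∉W)))
    grow (suc d) {W} bound W-conn W⊆C (a , a∈W) b∈C b∉W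
      with PathIn-exit (C-conn a _ (W⊆C a∈W) b∈C) a∈W b∉W
    ... | x , w , x∈W , w∈C , w∉W , xw with ⊆⊎∉ C (W ∪ ⁅ w ⁆)
    ...   | inj₁ C⊆W∪w = w , w∈C , w∉W , subst (Connected G) (≡-sym C-w≡W) W-conn
      where
      C-w≡W : C - w ≡ W
      C-w≡W = ⊆-antisym (p⊆q∪⁅y⁆⇒p-y⊆q C⊆W∪w) (q⊆p∧y∉q⇒q⊆p-y W⊆C w∉W)
    ...   | inj₂ (b′ , b′∈C , b′∉W∪w)
      with grow d bound′ (Connected-∪⁅⁆ W-conn x∈W xw) (p⊆r∧y∈r⇒p∪⁅y⁆⊆r W⊆C w∈C)
                (w , y∈p∪⁅y⁆ W w) b′∈C b′∉W∪w
      where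
      open ≤-Reasoning
      bound′ : ∣ C ∣ ≤ d + ∣ W ∪ ⁅ w ⁆ ∣
      bound′ = begin
        ∣ C ∣                ≤⟨ bound ⟩
        suc d + ∣ W ∣        ≡⟨ ≡-sym (+-suc d ∣ W ∣) ⟩
        d + suc ∣ W ∣        ≤⟨ +-monoʳ-≤ d (p⊂q⇒∣p∣<∣q∣ (p⊆p∪q ⁅ w ⁆ , w , y∈p∪⁅y⁆ W w , w∉W)) ⟩
        d + ∣ W ∪ ⁅ w ⁆ ∣    ∎
    ...     | v , v∈C , v∉W∪w , C-v-conn = v , v∈C , v∉W∪w ∘ p⊆p∪q ⁅ w ⁆ , C-v-conn

  module Correctness (conn? : (U : Subset n) → Dec (Connected G U)) (k : ℕ) (1≤k : 1 ≤ k) where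
    open TopDown G conn? k

    ∈-nonArt⁻ : ∀ {C x} → x ∈ₛ nonArt C → x ∈ₛ C × Connected G (C - x)
    ∈-nonArt⁻ {C} {x} x∈nonArt with Equivalence.to T-∧ (Equivalence.from T-≡
        (trans (≡-sym (lookup∘tabulate _ x)) ([]=⇒lookup x∈nonArt)))
    ... | x∈C? , C-x-conn? = toWitness {a? = x ∈? C} x∈C? , toWitness {a? = conn? (C - x)} C-x-conn?

    ∈-nonArt⁺ : ∀ {C x} → x ∈ₛ C → Connected G (C - x) → x ∈ₛ nonArt C
    ∈-nonArt⁺ {C} {x} x∈C C-x-conn = lookup⇒[]= x (nonArt C)
      (trans (lookup∘tabulate _ x)
             (Equivalence.to T-≡ (Equivalence.from T-∧
               (fromWitness {a? = x ∈? C} x∈C , fromWitness {a? = conn? (C - x)} C-x-conn))))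

    ∈-members⁺ : ∀ {S x} → x ∈ₛ S → x ∈ members S
    ∈-members⁺ {S} {x} = ∈-filter⁺ (_∈? S) (∈-allFin x)

    members-⊆ : ∀ {S T} → S ⊆ T → All (_∈ₛ T) (members S)
    members-⊆ {S} S⊆T = All.tabulate (S⊆T ∘ proj₂ ∘ ∈-filter⁻ (_∈? S) {xs = allFin n})

    CIS : Subset n → Set
    CIS U = Connected G U × ∣ U ∣ ≡ k

    mutual
      topDown-sound : ∀ f C N Y → Connected G C → N ⊆ nonArt C → All CIS (topDown f C N Y)
      topDown-sound zero    C N Y _      _   = []
      topDown-sound (suc f) C N Y C-conn N⊆ =
        ++⁺ (self (∣ C ∣ ≟ k)) (loop-sound f C (members N) Y (members-⊆ N⊆))
        where
        self : (size? : Dec (∣ C ∣ ≡ k)) → All CIS (if ⌊ size? ⌋ then C ∷ [] else [])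
        self (yes ∣C∣≡k) = (C-conn , ∣C∣≡k) ∷ []
        self (no  _)     = []

      loop-sound : ∀ f C us Y → All (_∈ₛ nonArt C) us → All CIS (loop f C us Y)
      loop-sound f C []       Y []           = []
      loop-sound f C (u ∷ us) Y (u∈nonArt ∷ us⊆nonArt) =
        ++⁺ (topDown-sound f (C - u) (nonArt (C - u) ─ Y) Y (proj₂ (∈-nonArt⁻ u∈nonArt)) (p─q⊆p _ Y))
            (rest (∣ Y ∪ ⁅ u ⁆ ∣ ≟ k) (conn? (Y ∪ ⁅ u ⁆)))
        where
        rest : (size? : Dec (∣ Y ∪ ⁅ u ⁆ ∣ ≡ k)) (conn?′ : Dec (Connected G (Y ∪ ⁅ u ⁆))) →
               All CIS (if ⌊ size? ⌋ then (if isYes conn?′ then Y ∪ ⁅ u ⁆ ∷ [] else [])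
                                     else loop f C us (Y ∪ ⁅ u ⁆))
        rest (yes ∣Y′∣≡k) (yes Y′-conn) = (Y′-conn , ∣Y′∣≡k) ∷ []
        rest (yes _)      (no  _)       = []
        rest (no  _)      _             = loop-sound f C us (Y ∪ ⁅ u ⁆) us⊆nonArt

    Any-members-∉ : ∀ {C N Y U b} → Connected G C → nonArt C ─ Y ⊆ N → Y ⊆ U → U ⊆ C →
                    CIS U → b ∈ₛ C → b ∉ₛ U → Any (_∉ₛ U) (members N)
    Any-members-∉ C-conn unguarded⊆N Y⊆U U⊆C (U-conn , ∣U∣≡k) b∈C b∉U
      with ∃-deletable-outside C-conn U-conn U⊆C (0<∣p∣⇒Nonempty (subst (0 <_) (≡-sym ∣U∣≡k) 1≤k)) b∈C b∉U
    ... | v , v∈C , v∉U , C-v-conn =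
      lose (∈-members⁺ (unguarded⊆N (x∈p∧x∉q⇒x∈p─q (∈-nonArt⁺ v∈C C-v-conn) (v∉U ∘ Y⊆U)))) v∉U

    mutual
      topDown-complete : ∀ f C N Y {U} → Connected G C → N ⊆ nonArt C → nonArt C ─ Y ⊆ N →
                         Y ⊆ U → U ⊆ C → CIS U → ∣ C ∣ < f → U ∈ topDown f C N Y
      topDown-complete (suc f) C N Y {U} C-conn N⊆ unguarded⊆N Y⊆U U⊆C U-cis@(_ , ∣U∣≡k) (s≤s ∣C∣≤f) =
        self-or-loop (∣ C ∣ ≟ k)
        where
        self-or-loop : (size? : Dec (∣ C ∣ ≡ k)) →
                       U ∈ (if ⌊ size? ⌋ then C ∷ [] else []) ++ loop f C (members N) Y
        self-or-loop (yes ∣C∣≡k) = here (p⊆q∧∣p∣≡∣q∣⇒p≡q U⊆C (trans ∣U∣≡k (≡-sym ∣C∣≡k)))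
        self-or-loop (no ∣C∣≢k) with ⊆⊎∉ C U
        ... | inj₁ C⊆U             = contradiction (trans (cong ∣_∣ (⊆-antisym C⊆U U⊆C)) ∣U∣≡k) ∣C∣≢k
        ... | inj₂ (b , b∈C , b∉U) = ∈-++⁺ʳ _
          (loop-complete f C (members N) Y (members-⊆ N⊆)
             (Any-members-∉ C-conn unguarded⊆N Y⊆U U⊆C U-cis b∈C b∉U) Y⊆U U⊆C U-cis ∣C∣≤f)

      loop-complete : ∀ f C us Y {U} → All (_∈ₛ nonArt C) us → Any (_∉ₛ U) us →
                      Y ⊆ U → U ⊆ C → CIS U → ∣ C ∣ ≤ f → U ∈ loop f C us Y
      loop-complete f C (u ∷ us) Y {U} (u∈nonArt ∷ us⊆nonArt) escapes Y⊆U U⊆C U-cis@(U-conn , ∣U∣≡k) ∣C∣≤f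
        with ∈-nonArt⁻ u∈nonArt | u ∈? U
      ... | u∈C , C-u-conn | no u∉U = ∈-++⁺ˡ
        (topDown-complete f (C - u) (nonArt (C - u) ─ Y) Y C-u-conn (p─q⊆p _ Y) ⊆-refl
           Y⊆U (q⊆p∧y∉q⇒q⊆p-y U⊆C u∉U) U-cis (<-≤-trans (x∈p⇒∣p-x∣<∣p∣ u∈C) ∣C∣≤f))
      ... | _ | yes u∈U = ∈-++⁺ʳ _ (rest (∣ Y ∪ ⁅ u ⁆ ∣ ≟ k) (conn? (Y ∪ ⁅ u ⁆)))
        where
        Y′⊆U : Y ∪ ⁅ u ⁆ ⊆ U
        Y′⊆U = p⊆r∧y∈r⇒p∪⁅y⁆⊆r Y⊆U u∈U

        escapes′ : Any (_∉ₛ U) us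
        escapes′ = case escapes of λ where
          (here u∉U)  → contradiction u∈U u∉U
          (there esc) → esc

        rest : (size? : Dec (∣ Y ∪ ⁅ u ⁆ ∣ ≡ k)) (conn?′ : Dec (Connected G (Y ∪ ⁅ u ⁆))) →
               U ∈ (if ⌊ size? ⌋ then (if isYes conn?′ then Y ∪ ⁅ u ⁆ ∷ [] else [])
                                 else loop f C us (Y ∪ ⁅ u ⁆))
        rest (yes ∣Y′∣≡k) conn?′ with p⊆q∧∣p∣≡∣q∣⇒p≡q Y′⊆U (trans ∣Y′∣≡k (≡-sym ∣U∣≡k))
        rest (yes _) (yes _)      | Y′≡U = here (≡-sym Y′≡U)
        rest (yes _) (no ¬Y′-conn) | Y′≡U = contradiction (subst (Connected G) (≡-sym Y′≡U) U-conn) ¬Y′-conn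
        rest (no _)  _             = loop-complete f C us (Y ∪ ⁅ u ⁆) us⊆nonArt escapes′ Y′⊆U U⊆C U-cis ∣C∣≤f

lemma2 : ∀ {n : ℕ} (G : Graph n) (conn? : (U : Subset n) → Dec (Connected G U))
         (k : ℕ) → 1 ≤ k → Connected G ⊤ →
         ∀ (U : Subset n) →
         (U ∈ TopDown.output G conn? k) ⇔ (Connected G U × ∣ U ∣ ≡ k)
lemma2 {n} G conn? k 1≤k V-conn U = mk⇔
  (All.lookup (topDown-sound (suc n) ⊤ (nonArt ⊤) ∅ V-conn ⊆-refl))
  (λ U-cis → topDown-complete (suc n) ⊤ (nonArt ⊤) ∅ V-conn ⊆-refl (p─q⊆p _ ∅) (⊆-min U) ⊆⊤
                              U-cis (s≤s (≤-reflexive (∣⊤∣≡n n))))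
  where
  open TopDown G conn? k
  open Correctness G conn? k 1≤k
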